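{- Let $n \ge 2$. Let $\pi_1,\pi_2,\pi_3$ be permutations of $\{1,\ldots,n^2\}$, let $0\le k\le n^2$, let $\{i_1,\ldots,i_k\}\subset\{1,\ldots,n^2\}$ and let $g_{i_1},\ldots,g_{i_k}\in\mathbb{Z}$ with $1\le g_{i_l}\le n$. Let $x\in\mathbb{Z}^{n^2}$ be a solution of the generalized Sudoku problem with these data, i.e. $1\le x_i\le n$ for all $i$, $A_{\pi_r}x<>\mathbf{0}$ for $r=1,2,3$, and $x_{i_l}=g_{i_l}$ for $l=1,\ldots,k$. Then \[ g_{i_l} = \frac{1}{2}\left[ A_{\pi_r}^T\, \mathrm{sgn}(A_{\pi_r} x) + (n+1)\mathbf{1}_{n^2}\right]_{i_l} \] for each $l=1,\ldots,k$ and each $r=1,2,3$, where $[v]_i$ denotes the $i$-th component of a vector $v$.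
   Context: For $n\ge 1$ let $s(n)=n(n-1)/2$. The matrix $A(n)$ is the $s(n)\times n$ integer matrix whose rows are indexed by the pairs $(i,j)$ with $1\le i<j\le n$, in lexicographic order; the row for $(i,j)$ has entry $+1$ in column $i$, $-1$ in column $j$, and $0$ elsewhere. The matrix $A$ is the $n\,s(n)\times n^2$ block diagonal matrix with $n$ diagonal blocks each equal to $A(n)$. For a permutation $\pi$ of $\{1,\ldots,n^2\}$, $A_\pi$ is the matrix whose $j$-th column is the $\pi^{ -1}(j)$-th column of $A$. For $y\in\mathbb{Z}^s$, $y<>\mathbf{0}$ means every component of $y$ is nonzero, and then $\mathrm{sgn}(y)$ is the vector of componentwise signs. $\mathbf{1}_m$ is the all-ones vector in $\mathbb{Z}^m$. -}

module Defs where

open import Data.Nat as ℕ using (ℕ; suc)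
open import Data.Integer as ℤ using (ℤ; +_; -[1+_]; _+_; _*_; -_)
open import Data.Fin as Fin using (Fin; toℕ; combine; remQuot)
open import Data.Fin.Permutation using (Permutation′; _⟨$⟩ʳ_; _⟨$⟩ˡ_)
open import Data.List as List using (List; []; _∷_; map; zipWith; concatMap; allFin; foldr)
open import Data.Product using (_,_)
open import Relation.Nullary.Decidable using (does)
open import Data.Bool using (if_then_else_)

-- vectors in ℤ^m are functions Fin m → ℤ;
-- a matrix with c columns is a list of its rows (each row : Fin c → ℤ),
-- listed in the order of the row index.
Row : ℕ → Set
Row c = Fin c → ℤ

Matrix : ℕ → Set
Matrix c = List (Row c)

∑ : List ℤ → ℤ
∑ = foldr _+_ (+ 0)

s : ℕ → ℕ
s n = (n ℕ.* (n ℕ.∸ 1)) ℕ./ 2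

pairRow : {n : ℕ} → Fin n → Fin n → Row n
pairRow i j c =
  if does (c Fin.≟ i) then + 1 else (if does (c Fin.≟ j) then - (+ 1) else + 0)

An : (n : ℕ) → Matrix n
An n = concatMap (λ i → concatMap (λ j →
          if does (toℕ i ℕ.<? toℕ j) then pairRow i j ∷ [] else [])
        (allFin n)) (allFin n)

-- A: block diagonal with n blocks equal to A(n); column c of A (c : Fin (n*n))
-- is column (c mod n) of block (c div n), i.e. combine b i = b*n + i.
blockRow : (n : ℕ) → Fin n → Row n → Row (n ℕ.* n)
blockRow n b r c with remQuot n c
... | (b' , i) = if does (b' Fin.≟ b) then r i else + 0

A : (n : ℕ) → Matrix (n ℕ.* n)
A n = concatMap (λ b → map (blockRow n b) (An n)) (allFin n)

-- A_π: the j-th column of A_π is the π⁻¹(j)-th column of A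
Aπ : (n : ℕ) → Permutation′ (n ℕ.* n) → Matrix (n ℕ.* n)
Aπ n π = map (λ r j → r (π ⟨$⟩ˡ j)) (A n)

mulVec : {c : ℕ} → Matrix c → (Fin c → ℤ) → List ℤ
mulVec {c} M x = map (λ r → ∑ (map (λ j → r j * x j) (allFin c))) M

mulVecᵀ : {c : ℕ} → Matrix c → List ℤ → Fin c → ℤ
mulVecᵀ M y j = ∑ (zipWith (λ r yr → r j * yr) M y)

sgn : ℤ → ℤ
sgn (+ 0) = + 0
sgn (+ (suc _)) = + 1
sgn -[1+ _ ] = - (+ 1)

module Submission where

-- Permuting the columns of A only reindexes x, so it suffices to treat A itself. A is block
-- diagonal, and in the block b containing coordinate c = (b , i) the row of the pair (i′ , j′)
-- is e_i′ − e_j′, so (Aᵀ sgn (A x))_c collapses to ∑_j sgn (w_i − w_j) with w = x restricted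
-- to block b. The constraint A x <> 0 makes w injective, hence a bijection onto {1, …, n},
-- and then ∑_j sgn (w_i − w_j) = (w_i − 1) − (n − w_i) = 2 w_i − (n + 1).

open import Defs
open import Data.Nat as ℕ using (ℕ; _≥_; zero; suc)
open import Data.Integer as ℤ using (ℤ; +_; -[1+_]; _+_; _*_; -_; _-_)
open import Data.Integer.Tactic.RingSolver using (solve-∀)
import Data.Nat.Properties as ℕP
import Data.Integer.Properties as ℤP
open import Data.Fin as Fin using (Fin; toℕ; combine; remQuot; punchIn; punchOut; _↑ˡ_; _↑ʳ_)
import Data.Fin.Properties as FinP
open import Data.Fin.Permutation using (Permutation′; _⟨$⟩ʳ_; _⟨$⟩ˡ_; inverseˡ; inverseʳ; permutation)
open import Data.List using (List; []; _∷_; map; allFin; tabulate; concatMap; _++_)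
import Data.List.Properties as ListP
open import Data.Product using (Σ; _×_; _,_; proj₁; proj₂; ∃)
open import Relation.Nullary.Negation using (contradiction)
open import Data.List.Relation.Unary.All as All using (All)
open import Data.List.Relation.Unary.Any using (here)
open import Data.List.Membership.Propositional using (_∈_; lose)
open import Data.List.Membership.Propositional.Properties using (∈-map⁺; ∈-concatMap⁺; ∈-allFin)
open import Function using (_∘_)
open import Relation.Binary.Definitions using (tri<; tri≈; tri>)
open import Function.Definitions using (Injective)
open import Relation.Binary.PropositionalEquality
open import Relation.Nullary using (yes; no; ¬_; does)
open import Relation.Nullary.Decidable using (dec-true; dec-false)
open import Data.Bool using (if_then_else_)
open import Algebra.Properties.CommutativeMonoid.Sum ℤP.+-0-commutativeMonoid
  using (sum; sum-remove; sum-cong-≗; sum-replicate-zero; ∑-distrib-+; sum-permute)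

∑-++ : (xs ys : List ℤ) → ∑ (xs ++ ys) ≡ ∑ xs + ∑ ys
∑-++ []       ys = sym (ℤP.+-identityˡ _)
∑-++ (x ∷ xs) ys = trans (cong (_+_ x) (∑-++ xs ys)) (sym (ℤP.+-assoc x _ _))

∑-map-concatMap : ∀ {A B : Set} (f : B → ℤ) (g : A → List B) (xs : List A) →
  ∑ (map f (concatMap g xs)) ≡ ∑ (map (λ a → ∑ (map f (g a))) xs)
∑-map-concatMap f g []       = refl
∑-map-concatMap f g (x ∷ xs) = begin
  ∑ (map f (g x ++ concatMap g xs))
    ≡⟨ cong ∑ (ListP.map-++ f (g x) _) ⟩
  ∑ (map f (g x) ++ map f (concatMap g xs))
    ≡⟨ ∑-++ (map f (g x)) _ ⟩
  ∑ (map f (g x)) + ∑ (map f (concatMap g xs))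
    ≡⟨ cong (_+_ (∑ (map f (g x)))) (∑-map-concatMap f g xs) ⟩
  ∑ (map f (g x)) + ∑ (map (λ a → ∑ (map f (g a))) xs) ∎
  where open ≡-Reasoning

∑-map-zero : ∀ {A : Set} {f : A → ℤ} (xs : List A) → (∀ a → f a ≡ + 0) → ∑ (map f xs) ≡ + 0
∑-map-zero []       f≡0 = refl
∑-map-zero (x ∷ xs) f≡0 = cong₂ _+_ (f≡0 x) (∑-map-zero xs f≡0)

∑-tabulate : ∀ {n} (f : Fin n → ℤ) → ∑ (tabulate f) ≡ sum f
∑-tabulate {zero}  f = refl
∑-tabulate {suc n} f = cong (_+_ (f Fin.zero)) (∑-tabulate (f ∘ Fin.suc))

∑-allFin : ∀ {n} (f : Fin n → ℤ) → ∑ (map f (allFin n)) ≡ sum f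
∑-allFin f = trans (cong ∑ (ListP.map-tabulate (λ i → i) f)) (∑-tabulate f)

sum-zero : ∀ {n} {f : Fin n → ℤ} → (∀ i → f i ≡ + 0) → sum f ≡ + 0
sum-zero {n} f≡0 = trans (sum-cong-≗ f≡0) (sum-replicate-zero n)

sum-pointSupported : ∀ {n} (f : Fin n → ℤ) (p : Fin n) →
  (∀ i → i ≢ p → f i ≡ + 0) → sum f ≡ f p
sum-pointSupported {suc n} f p f≡0 = begin
  sum f                         ≡⟨ sum-remove {i = p} f ⟩
  f p + sum (f ∘ punchIn p)     ≡⟨ cong (_+_ (f p)) (sum-zero (λ k → f≡0 _ (FinP.punchInᵢ≢i p k))) ⟩
  f p + + 0                     ≡⟨ ℤP.+-identityʳ (f p) ⟩
  f p                           ∎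
  where open ≡-Reasoning

sum-twoPointSupported : ∀ {n} (f : Fin n → ℤ) {p q : Fin n} → p ≢ q →
  (∀ i → i ≢ p → i ≢ q → f i ≡ + 0) → sum f ≡ f p + f q
sum-twoPointSupported {suc n} f {p} {q} p≢q f≡0 = begin
  sum f
    ≡⟨ sum-remove {i = p} f ⟩
  f p + sum (f ∘ punchIn p)
    ≡⟨ cong (_+_ (f p)) (sum-pointSupported (f ∘ punchIn p) (punchOut p≢q) off-q) ⟩
  f p + f (punchIn p (punchOut p≢q))
    ≡⟨ cong (λ i → f p + f i) (FinP.punchIn-punchOut p≢q) ⟩
  f p + f q ∎
  where
  open ≡-Reasoning
  off-q : ∀ k → k ≢ punchOut p≢q → f (punchIn p k) ≡ + 0
  off-q k k≢ = f≡0 _ (FinP.punchInᵢ≢i p k) λ eq →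
    k≢ (FinP.punchIn-injective p k _ (trans eq (sym (FinP.punchIn-punchOut p≢q))))

sum-crossSupported : ∀ {n} (f : Fin n → Fin n → ℤ) (p : Fin n) → f p p ≡ + 0 →
  (∀ i j → i ≢ p → j ≢ p → f i j ≡ + 0) →
  sum (λ i → sum (f i)) ≡ sum (λ j → f p j + f j p)
sum-crossSupported {suc n} f p fpp≡0 f≡0 = begin
  sum (λ i → sum (f i))                           ≡⟨ sum-remove {i = p} (λ i → sum (f i)) ⟩
  sum (f p) + sum (λ k → sum (f (punchIn p k)))    ≡⟨ cong (_+_ (sum (f p))) (sum-cong-≗ offRow) ⟩
  sum (f p) + sum (λ k → f (punchIn p k) p)        ≡⟨ cong (_+_ (sum (f p))) offColumn ⟩
  sum (f p) + sum (λ j → f j p)                    ≡⟨ ∑-distrib-+ (f p) (λ j → f j p) ⟨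
  sum (λ j → f p j + f j p)                        ∎
  where
  open ≡-Reasoning
  offRow : ∀ k → sum (f (punchIn p k)) ≡ f (punchIn p k) p
  offRow k = sum-pointSupported (f (punchIn p k)) p (λ j → f≡0 _ j (FinP.punchInᵢ≢i p k))
  offColumn : sum (λ k → f (punchIn p k) p) ≡ sum (λ j → f j p)
  offColumn = sym (trans (sum-remove {i = p} (λ j → f j p))
    (trans (cong (_+ sum (λ k → f (punchIn p k) p)) fpp≡0) (ℤP.+-identityˡ _)))

sum-↑ : ∀ m {n} (f : Fin (m ℕ.+ n) → ℤ) →
  sum f ≡ sum (λ i → f (i ↑ˡ n)) + sum (λ j → f (m ↑ʳ j))
sum-↑ zero    f = sym (ℤP.+-identityˡ _)
sum-↑ (suc m) {n} f = trans (cong (_+_ (f Fin.zero)) (sum-↑ m (f ∘ Fin.suc)))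
  (sym (ℤP.+-assoc (f Fin.zero) (sum (λ i → f (Fin.suc (i ↑ˡ n)))) (sum (λ j → f (suc m ↑ʳ j)))))

sum-combine : ∀ {m n} (f : Fin (m ℕ.* n) → ℤ) →
  sum f ≡ sum (λ (b : Fin m) → sum (λ (i : Fin n) → f (combine b i)))
sum-combine {zero}      f = refl
sum-combine {suc m} {n} f =
  trans (sum-↑ n {m ℕ.* n} f)
    (cong (_+_ (sum (λ i → f (i ↑ˡ (m ℕ.* n))))) (sum-combine {m} {n} (λ j → f (n ↑ʳ j))))

sgn-neg : ∀ a → sgn (- a) ≡ - sgn a
sgn-neg (+ zero)    = refl
sgn-neg (+ suc _)   = refl
sgn-neg (-[1+ _ ])  = refl

neg-minus : ∀ a b → - (a - b) ≡ b - a
neg-minus = solve-∀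

_·_ : ∀ {c} → Row c → (Fin c → ℤ) → ℤ
_·_ {c} r x = ∑ (map (λ j → r j * x j) (allFin c))

·-sum : ∀ {c} (r : Row c) (x : Fin c → ℤ) → r · x ≡ sum (λ j → r j * x j)
·-sum r x = ∑-allFin (λ j → r j * x j)

sgnColumnSum : ∀ {c} → Matrix c → (Fin c → ℤ) → Fin c → ℤ
sgnColumnSum M x j = ∑ (map (λ r → r j * sgn (r · x)) M)

mulVecᵀ-sgn-mulVec : ∀ {c} (M : Matrix c) (x : Fin c → ℤ) (j : Fin c) →
  mulVecᵀ M (map sgn (mulVec M x)) j ≡ sgnColumnSum M x j
mulVecᵀ-sgn-mulVec []      x j = refl
mulVecᵀ-sgn-mulVec (r ∷ M) x j = cong (_+_ (r j * sgn (r · x))) (mulVecᵀ-sgn-mulVec M x j)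

module _ {c} (P : Permutation′ c) where

  ·-permuteColumns : (r : Row c) (x : Fin c → ℤ) → (λ j → r (P ⟨$⟩ˡ j)) · x ≡ r · (x ∘ (P ⟨$⟩ʳ_))
  ·-permuteColumns r x = begin
    (λ j → r (P ⟨$⟩ˡ j)) · x
      ≡⟨ ·-sum (λ j → r (P ⟨$⟩ˡ j)) x ⟩
    sum (λ j → r (P ⟨$⟩ˡ j) * x j)
      ≡⟨ sum-permute _ P ⟩
    sum (λ k → r (P ⟨$⟩ˡ (P ⟨$⟩ʳ k)) * x (P ⟨$⟩ʳ k))
      ≡⟨ sum-cong-≗ (λ k → cong (λ i → r i * x (P ⟨$⟩ʳ k)) (inverseˡ P)) ⟩
    sum (λ k → r k * x (P ⟨$⟩ʳ k))
      ≡⟨ sym (·-sum r _) ⟩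
    r · (x ∘ (P ⟨$⟩ʳ_)) ∎
    where open ≡-Reasoning

  mulVec-permuteColumns : (M : Matrix c) (x : Fin c → ℤ) →
    mulVec (map (λ r j → r (P ⟨$⟩ˡ j)) M) x ≡ mulVec M (x ∘ (P ⟨$⟩ʳ_))
  mulVec-permuteColumns []      x = refl
  mulVec-permuteColumns (r ∷ M) x = cong₂ _∷_ (·-permuteColumns r x) (mulVec-permuteColumns M x)

  sgnColumnSum-permuteColumns : (M : Matrix c) (x : Fin c → ℤ) (t : Fin c) →
    sgnColumnSum (map (λ r j → r (P ⟨$⟩ˡ j)) M) x t ≡ sgnColumnSum M (x ∘ (P ⟨$⟩ʳ_)) (P ⟨$⟩ˡ t)
  sgnColumnSum-permuteColumns []      x t = refl
  sgnColumnSum-permuteColumns (r ∷ M) x t =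
    cong₂ _+_ (cong (λ v → r (P ⟨$⟩ˡ t) * sgn v) (·-permuteColumns r x))
              (sgnColumnSum-permuteColumns M x t)

pairRows : ∀ {n} → Fin n → Fin n → List (Row n)
pairRows i j = if does (toℕ i ℕ.<? toℕ j) then pairRow i j ∷ [] else []

module _ (n : ℕ) where

  blockRow-combine : ∀ b (r : Row n) b' i →
    blockRow n b r (combine b' i) ≡ (if does (b' Fin.≟ b) then r i else + 0)
  blockRow-combine b r b' i =
    cong (λ q → if does (proj₁ q Fin.≟ b) then r (proj₂ q) else + 0) (FinP.remQuot-combine b' i)

  blockRow-on : ∀ b (r : Row n) i → blockRow n b r (combine b i) ≡ r i
  blockRow-on b r i rewrite blockRow-combine b r b i | dec-true (b Fin.≟ b) refl = refl

  blockRow-off : ∀ {b b'} (r : Row n) i → b' ≢ b → blockRow n b r (combine b' i) ≡ + 0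
  blockRow-off {b} {b'} r i b'≢b rewrite blockRow-combine b r b' i | dec-false (b' Fin.≟ b) b'≢b = refl

  ·-blockRow : ∀ b (r : Row n) (z : Fin (n ℕ.* n) → ℤ) → blockRow n b r · z ≡ r · (z ∘ combine b)
  ·-blockRow b r z = begin
    blockRow n b r · z
      ≡⟨ ·-sum (blockRow n b r) z ⟩
    sum (λ c → blockRow n b r c * z c)
      ≡⟨ sum-combine {n} {n} (λ c → blockRow n b r c * z c) ⟩
    sum (λ (b' : Fin n) → sum (λ (i : Fin n) → blockRow n b r (combine b' i) * z (combine b' i)))
      ≡⟨ sum-pointSupported _ b offBlock ⟩
    sum (λ i → blockRow n b r (combine b i) * z (combine b i))
      ≡⟨ sum-cong-≗ (λ i → cong (_* z (combine b i)) (blockRow-on b r i)) ⟩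
    sum (λ i → r i * z (combine b i))
      ≡⟨ sym (·-sum r (z ∘ combine b)) ⟩
    r · (z ∘ combine b) ∎
    where
    open ≡-Reasoning
    offBlock : ∀ b' → b' ≢ b →
      sum (λ (i : Fin n) → blockRow n b r (combine b' i) * z (combine b' i)) ≡ + 0
    offBlock b' b'≢b = sum-zero λ i →
      trans (cong (_* z (combine b' i)) (blockRow-off r i b'≢b)) (ℤP.*-zeroˡ (z (combine b' i)))

  sgnColumnSum-A : ∀ (z : Fin (n ℕ.* n) → ℤ) b i →
    sgnColumnSum (A n) z (combine b i) ≡ sgnColumnSum (An n) (z ∘ combine b) i
  sgnColumnSum-A z b i = begin
    sgnColumnSum (A n) z (combine b i)
      ≡⟨ ∑-map-concatMap F _ (allFin n) ⟩
    ∑ (map (λ b' → ∑ (map F (map (blockRow n b') (An n)))) (allFin n))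
      ≡⟨ ∑-allFin (λ b' → ∑ (map F (map (blockRow n b') (An n)))) ⟩
    sum (λ b' → ∑ (map F (map (blockRow n b') (An n))))
      ≡⟨ sum-cong-≗ (λ b' → cong ∑ (sym (ListP.map-∘ {g = F} {f = blockRow n b'} (An n)))) ⟩
    sum (λ b' → ∑ (map (F ∘ blockRow n b') (An n)))
      ≡⟨ sum-pointSupported _ b offBlock ⟩
    ∑ (map (F ∘ blockRow n b) (An n))
      ≡⟨ cong ∑ (ListP.map-cong onBlock (An n)) ⟩
    sgnColumnSum (An n) (z ∘ combine b) i ∎
    where
    open ≡-Reasoning
    F : Row (n ℕ.* n) → ℤ
    F ρ = ρ (combine b i) * sgn (ρ · z)
    offBlock : ∀ b' → b' ≢ b → ∑ (map (F ∘ blockRow n b') (An n)) ≡ + 0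
    offBlock b' b'≢b = ∑-map-zero (An n) λ r →
      trans (cong (_* sgn (blockRow n b' r · z)) (blockRow-off r i (b'≢b ∘ sym)))
            (ℤP.*-zeroˡ (sgn (blockRow n b' r · z)))
    onBlock : ∀ r → F (blockRow n b r) ≡ r i * sgn (r · (z ∘ combine b))
    onBlock r = cong₂ (λ u v → u * sgn v) (blockRow-on b r i) (·-blockRow b r z)

  pairRow-left : ∀ (i j : Fin n) → pairRow i j i ≡ + 1
  pairRow-left i j rewrite dec-true (i Fin.≟ i) refl = refl

  pairRow-right : ∀ {i j : Fin n} → i ≢ j → pairRow i j j ≡ - + 1
  pairRow-right {i} {j} i≢j rewrite dec-false (j Fin.≟ i) (i≢j ∘ sym) | dec-true (j Fin.≟ j) refl = refl

  pairRow-outside : ∀ {i j c : Fin n} → c ≢ i → c ≢ j → pairRow i j c ≡ + 0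
  pairRow-outside {i} {j} {c} c≢i c≢j rewrite dec-false (c Fin.≟ i) c≢i | dec-false (c Fin.≟ j) c≢j = refl

  ·-pairRow : ∀ {i j : Fin n} (w : Fin n → ℤ) → i ≢ j → pairRow i j · w ≡ w i - w j
  ·-pairRow {i} {j} w i≢j = begin
    pairRow i j · w                               ≡⟨ ·-sum (pairRow i j) w ⟩
    sum (λ c → pairRow i j c * w c)               ≡⟨ sum-twoPointSupported _ i≢j outside ⟩
    pairRow i j i * w i + pairRow i j j * w j     ≡⟨ cong₂ _+_ left right ⟩
    w i - w j                                     ∎
    where
    open ≡-Reasoning
    outside : ∀ c → c ≢ i → c ≢ j → pairRow i j c * w c ≡ + 0
    outside c c≢i c≢j = trans (cong (_* w c) (pairRow-outside c≢i c≢j)) (ℤP.*-zeroˡ (w c))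
    left : pairRow i j i * w i ≡ w i
    left = trans (cong (_* w i) (pairRow-left i j)) (ℤP.*-identityˡ (w i))
    right : pairRow i j j * w j ≡ - w j
    right = trans (cong (_* w j) (pairRow-right i≢j)) (ℤP.-1*i≡-i (w j))

  module _ (w : Fin n → ℤ) (p : Fin n) where

    pairTerm : Fin n → Fin n → ℤ
    pairTerm i j = sgnColumnSum (pairRows i j) w p

    pairTerm-< : ∀ {i j} → toℕ i ℕ.< toℕ j → pairTerm i j ≡ pairRow i j p * sgn (w i - w j)
    pairTerm-< {i} {j} i<j rewrite dec-true (toℕ i ℕ.<? toℕ j) i<j =
      trans (ℤP.+-identityʳ _) (cong (λ v → pairRow i j p * sgn v) (·-pairRow w i≢j))
      where
      i≢j : i ≢ j
      i≢j i≡j = ℕP.<-irrefl (cong toℕ i≡j) i<j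

    pairTerm-≮ : ∀ {i j} → ¬ toℕ i ℕ.< toℕ j → pairTerm i j ≡ + 0
    pairTerm-≮ {i} {j} i≮j rewrite dec-false (toℕ i ℕ.<? toℕ j) i≮j = refl

    pairTerm-outside : ∀ i j → i ≢ p → j ≢ p → pairTerm i j ≡ + 0
    pairTerm-outside i j i≢p j≢p with toℕ i ℕ.<? toℕ j
    ... | yes i<j = trans (pairTerm-< i<j)
      (trans (cong (_* sgn (w i - w j)) (pairRow-outside (i≢p ∘ sym) (j≢p ∘ sym)))
             (ℤP.*-zeroˡ (sgn (w i - w j))))
    ... | no i≮j = pairTerm-≮ i≮j

    pairTerm-cross : ∀ j → pairTerm p j + pairTerm j p ≡ sgn (w p - w j)
    pairTerm-cross j with ℕP.<-cmp (toℕ p) (toℕ j)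
    ... | tri< p<j _ j≮p = begin
      pairTerm p j + pairTerm j p             ≡⟨ cong₂ _+_ (pairTerm-< p<j) (pairTerm-≮ j≮p) ⟩
      pairRow p j p * sgn (w p - w j) + + 0   ≡⟨ ℤP.+-identityʳ _ ⟩
      pairRow p j p * sgn (w p - w j)         ≡⟨ cong (_* sgn (w p - w j)) (pairRow-left p j) ⟩
      + 1 * sgn (w p - w j)                   ≡⟨ ℤP.*-identityˡ _ ⟩
      sgn (w p - w j)                         ∎
      where open ≡-Reasoning
    ... | tri≈ p≮j p≡j _ = begin
      pairTerm p j + pairTerm j p
        ≡⟨ cong₂ _+_ (pairTerm-≮ p≮j) (pairTerm-≮ (ℕP.<-irrefl (sym p≡j))) ⟩
      + 0
        ≡⟨ cong sgn (ℤP.i≡j⇒i-j≡0 (cong w (FinP.toℕ-injective p≡j))) ⟨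
      sgn (w p - w j) ∎
      where open ≡-Reasoning
    ... | tri> p≮j _ j<p = begin
      pairTerm p j + pairTerm j p             ≡⟨ cong₂ _+_ (pairTerm-≮ p≮j) (pairTerm-< j<p) ⟩
      + 0 + pairRow j p p * sgn (w j - w p)   ≡⟨ ℤP.+-identityˡ _ ⟩
      pairRow j p p * sgn (w j - w p)         ≡⟨ cong (_* sgn (w j - w p)) (pairRow-right j≢p) ⟩
      - + 1 * sgn (w j - w p)                 ≡⟨ ℤP.-1*i≡-i _ ⟩
      - sgn (w j - w p)                       ≡⟨ sgn-neg (w j - w p) ⟨
      sgn (- (w j - w p))                     ≡⟨ cong sgn (neg-minus (w j) (w p)) ⟩
      sgn (w p - w j)                         ∎
      where
      open ≡-Reasoning
      j≢p : j ≢ p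
      j≢p j≡p = ℕP.<-irrefl (cong toℕ j≡p) j<p

    sgnColumnSum-An : sgnColumnSum (An n) w p ≡ sum (λ j → sgn (w p - w j))
    sgnColumnSum-An = begin
      sgnColumnSum (An n) w p
        ≡⟨ ∑-map-concatMap F _ (allFin n) ⟩
      ∑ (map (λ i → ∑ (map F (row i))) (allFin n))
        ≡⟨ ∑-allFin (λ i → ∑ (map F (row i))) ⟩
      sum (λ i → ∑ (map F (row i)))
        ≡⟨ sum-cong-≗ rowSum ⟩
      sum (λ i → sum (pairTerm i))
        ≡⟨ sum-crossSupported pairTerm p (pairTerm-≮ {p} {p} (ℕP.<-irrefl refl)) pairTerm-outside ⟩
      sum (λ j → pairTerm p j + pairTerm j p)
        ≡⟨ sum-cong-≗ pairTerm-cross ⟩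
      sum (λ j → sgn (w p - w j)) ∎
      where
      open ≡-Reasoning
      F : Row n → ℤ
      F r = r p * sgn (r · w)
      row : Fin n → List (Row n)
      row i = concatMap (pairRows i) (allFin n)
      rowSum : ∀ i → ∑ (map F (row i)) ≡ sum (pairTerm i)
      rowSum i = trans (∑-map-concatMap F _ (allFin n)) (∑-allFin (pairTerm i))

injective⇒surjective : ∀ {n} (f : Fin n → Fin n) → Injective _≡_ _≡_ f → ∀ y → ∃ λ x → f x ≡ y
injective⇒surjective {suc m} f f-inj y with FinP.any? (λ x → f x Fin.≟ y)
... | yes found = found
... | no none = contradiction (FinP.injective⇒≤ punchOut∘f-inj) ℕP.1+n≰n
  where
  -- otherwise f injects Fin (suc m) into Fin (suc m) ∖ {y} ≅ Fin m
  y≢f : ∀ x → y ≢ f x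
  y≢f x y≡fx = none (x , sym y≡fx)
  punchOut∘f-inj : Injective _≡_ _≡_ (λ x → punchOut (y≢f x))
  punchOut∘f-inj {a} {b} eq = f-inj (FinP.punchOut-injective (y≢f a) (y≢f b) eq)

injective⇒permutation : ∀ {n} (f : Fin n → Fin n) → Injective _≡_ _≡_ f → Permutation′ n
injective⇒permutation {n} f f-inj =
  permutation f (proj₁ ∘ preimage) (proj₂ ∘ preimage) (λ x → f-inj (proj₂ (preimage (f x))))
  where
  preimage : ∀ (y : Fin n) → ∃ λ x → f x ≡ y
  preimage = injective⇒surjective f f-inj

sum-sgn-negative : ∀ m → sum (λ (k : Fin m) → sgn (+ 0 - + suc (toℕ k))) ≡ - + m
sum-sgn-negative zero    = refl
sum-sgn-negative (suc m) = trans (cong (_+_ (- + 1)) (sum-sgn-negative m)) (neg-1+ (+ m))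
  where
  neg-1+ : ∀ a → - + 1 + - a ≡ - (+ 1 + a)
  neg-1+ = solve-∀

sgn-pred-pred : ∀ a b → sgn (+ suc a - + suc b) ≡ sgn (+ a - + b)
sgn-pred-pred a b = cong sgn (minus-1+ (+ a) (+ b))
  where
  minus-1+ : ∀ x y → (+ 1 + x) - (+ 1 + y) ≡ x - y
  minus-1+ = solve-∀

-- ∑_{k<n} sgn (c - k) = c - (n - 1 - c), written without subtraction.
sum-sgn-range : ∀ c n → c ℕ.< n → sum (λ (k : Fin n) → sgn (+ c - + toℕ k)) + + suc n ≡ + 2 * + suc c
sum-sgn-range zero (suc m) _ rewrite sum-sgn-negative m = base (+ m)
  where
  base : ∀ a → (+ 0 + - a) + (+ 2 + a) ≡ + 2 * + 1
  base = solve-∀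
sum-sgn-range (suc c) (suc n) (ℕ.s≤s c<n) = begin
  (+ 1 + sum (λ (k : Fin n) → sgn (+ suc c - + suc (toℕ k)))) + (+ 1 + + suc n)
    ≡⟨ cong (λ s → (+ 1 + s) + (+ 1 + + suc n)) (sum-cong-≗ {n} (λ k → sgn-pred-pred c (toℕ k))) ⟩
  (+ 1 + S) + (+ 1 + + suc n)     ≡⟨ shift S (+ suc n) ⟩
  (S + + suc n) + + 2             ≡⟨ cong (_+ + 2) (sum-sgn-range c n c<n) ⟩
  + 2 * + suc c + + 2             ≡⟨ double-suc (+ suc c) ⟩
  + 2 * (+ 1 + + suc c)           ∎
  where
  open ≡-Reasoning
  S : ℤ
  S = sum (λ (k : Fin n) → sgn (+ c - + toℕ k))
  shift : ∀ s a → (+ 1 + s) + (+ 1 + a) ≡ (s + a) + + 2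
  shift = solve-∀
  double-suc : ∀ a → + 2 * a + + 2 ≡ + 2 * (+ 1 + a)
  double-suc = solve-∀

toFin : ∀ {n} (z : ℤ) → + 1 ℤ.≤ z → z ℤ.≤ + n → Σ (Fin n) (λ k → z ≡ + suc (toℕ k))
toFin (+ zero)  (ℤ.+≤+ ()) _
toFin (+ suc m) _ (ℤ.+≤+ m<n) = Fin.fromℕ< m<n , cong (+_ ∘ suc) (sym (FinP.toℕ-fromℕ< m<n))

-- w is a bijection onto {1, …, n}, so the sum can be reindexed by the permutation it induces on Fin n.
sum-sgn-injective : ∀ {n} (w : Fin n → ℤ) → (∀ i → + 1 ℤ.≤ w i × w i ℤ.≤ + n) →
  Injective _≡_ _≡_ w → ∀ p → sum (λ j → sgn (w p - w j)) + + (n ℕ.+ 1) ≡ + 2 * w p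
sum-sgn-injective {n} w bounds w-inj p = begin
  sum (λ j → sgn (w p - w j)) + + (n ℕ.+ 1)
    ≡⟨ cong₂ _+_ (sum-cong-≗ (λ j → cong₂ (λ a b → sgn (a - b)) (w≡ p) (w≡ j))) (cong +_ (ℕP.+-comm n 1)) ⟩
  sum (g ∘ v) + + suc n
    ≡⟨ cong (_+ + suc n) (sum-permute g (injective⇒permutation v v-inj)) ⟨
  sum g + + suc n
    ≡⟨ cong (_+ + suc n) (sum-cong-≗ {n} (λ k → sgn-pred-pred (toℕ (v p)) (toℕ k))) ⟩
  sum (λ (k : Fin n) → sgn (+ toℕ (v p) - + toℕ k)) + + suc n
    ≡⟨ sum-sgn-range (toℕ (v p)) n (FinP.toℕ<n (v p)) ⟩
  + 2 * + suc (toℕ (v p))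
    ≡⟨ cong (+ 2 *_) (w≡ p) ⟨
  + 2 * w p ∎
  where
  open ≡-Reasoning
  v : Fin n → Fin n
  v j = proj₁ (toFin (w j) (proj₁ (bounds j)) (proj₂ (bounds j)))
  w≡ : ∀ j → w j ≡ + suc (toℕ (v j))
  w≡ j = proj₂ (toFin (w j) (proj₁ (bounds j)) (proj₂ (bounds j)))
  v-inj : Injective _≡_ _≡_ v
  v-inj {a} {b} va≡vb = w-inj (trans (w≡ a) (trans (cong (+_ ∘ suc ∘ toℕ) va≡vb) (sym (w≡ b))))
  g : Fin n → ℤ
  g k = sgn (+ suc (toℕ (v p)) - + suc (toℕ k))

pairRow∈An : ∀ {n} {i j : Fin n} → toℕ i ℕ.< toℕ j → pairRow i j ∈ An n
pairRow∈An {n} {i} {j} i<j =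
  ∈-concatMap⁺ (λ i → concatMap (pairRows i) (allFin n))
    (lose (∈-allFin i) (∈-concatMap⁺ (pairRows i) (lose (∈-allFin j) pairRow∈pairRows)))
  where
  pairRow∈pairRows : pairRow i j ∈ pairRows i j
  pairRow∈pairRows rewrite dec-true (toℕ i ℕ.<? toℕ j) i<j = here refl

blockRow∈A : ∀ {n} b {r : Row n} → r ∈ An n → blockRow n b r ∈ A n
blockRow∈A {n} b r∈An =
  ∈-concatMap⁺ (λ b → map (blockRow n b) (An n)) (lose (∈-allFin b) (∈-map⁺ (blockRow n b) r∈An))

module _ (n : ℕ) (z : Fin (n ℕ.* n) → ℤ) (nonzero : All (λ v → v ≢ + 0) (mulVec (A n) z))
         (b : Fin n) where

  block-distinct : ∀ {i j} → toℕ i ℕ.< toℕ j → z (combine b i) ≢ z (combine b j)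
  block-distinct {i} {j} i<j zi≡zj =
    All.lookup nonzero (∈-map⁺ (_· z) (blockRow∈A b (pairRow∈An i<j))) (begin
    blockRow n b (pairRow i j) · z
      ≡⟨ ·-blockRow n b (pairRow i j) z ⟩
    pairRow i j · (z ∘ combine b)
      ≡⟨ ·-pairRow n (z ∘ combine b) (λ i≡j → ℕP.<-irrefl (cong toℕ i≡j) i<j) ⟩
    z (combine b i) - z (combine b j)
      ≡⟨ ℤP.i≡j⇒i-j≡0 zi≡zj ⟩
    + 0 ∎)
    where open ≡-Reasoning

  block-injective : Injective _≡_ _≡_ (z ∘ combine b)
  block-injective {i} {j} zi≡zj with ℕP.<-cmp (toℕ i) (toℕ j)
  ... | tri< i<j _ _ = contradiction zi≡zj (block-distinct i<j)
  ... | tri≈ _ i≡j _ = FinP.toℕ-injective i≡j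
  ... | tri> _ _ j<i = contradiction (sym zi≡zj) (block-distinct j<i)

sgnColumnSum-A-recovers : ∀ n (z : Fin (n ℕ.* n) → ℤ) → (∀ c → + 1 ℤ.≤ z c × z c ℤ.≤ + n) →
  All (λ v → v ≢ + 0) (mulVec (A n) z) → ∀ c → + 2 * z c ≡ sgnColumnSum (A n) z c + + (n ℕ.+ 1)
sgnColumnSum-A-recovers n z bounds nonzero c =
  subst (λ c → + 2 * z c ≡ sgnColumnSum (A n) z c + + (n ℕ.+ 1)) (FinP.combine-remQuot {n} n c)
    (inBlock (proj₁ (remQuot {n} n c)) (proj₂ (remQuot {n} n c)))
  where
  inBlock : ∀ b i → + 2 * z (combine b i) ≡ sgnColumnSum (A n) z (combine b i) + + (n ℕ.+ 1)
  inBlock b i = begin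
    + 2 * z (combine b i)
      ≡⟨ sum-sgn-injective (z ∘ combine b) (bounds ∘ combine b) (block-injective n z nonzero b) i ⟨
    sum (λ j → sgn (z (combine b i) - z (combine b j))) + + (n ℕ.+ 1)
      ≡⟨ cong (_+ + (n ℕ.+ 1)) (sgnColumnSum-An n (z ∘ combine b) i) ⟨
    sgnColumnSum (An n) (z ∘ combine b) i + + (n ℕ.+ 1)
      ≡⟨ cong (_+ + (n ℕ.+ 1)) (sgnColumnSum-A n z b i) ⟨
    sgnColumnSum (A n) z (combine b i) + + (n ℕ.+ 1) ∎
    where open ≡-Reasoning

mulVecᵀ-Aπ-recovers : ∀ n (P : Permutation′ (n ℕ.* n)) (x : Fin (n ℕ.* n) → ℤ) →
  (∀ i → + 1 ℤ.≤ x i × x i ℤ.≤ + n) → All (λ v → v ≢ + 0) (mulVec (Aπ n P) x) →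
  ∀ t → + 2 * x t ≡ mulVecᵀ (Aπ n P) (map sgn (mulVec (Aπ n P) x)) t + + (n ℕ.+ 1)
mulVecᵀ-Aπ-recovers n P x bounds nonzero t = begin
  + 2 * x t
    ≡⟨ cong (λ u → + 2 * x u) (inverseʳ P) ⟨
  + 2 * z (P ⟨$⟩ˡ t)
    ≡⟨ sgnColumnSum-A-recovers n z (bounds ∘ (P ⟨$⟩ʳ_)) nonzero-z (P ⟨$⟩ˡ t) ⟩
  sgnColumnSum (A n) z (P ⟨$⟩ˡ t) + + (n ℕ.+ 1)
    ≡⟨ cong (_+ + (n ℕ.+ 1)) (sgnColumnSum-permuteColumns P (A n) x t) ⟨
  sgnColumnSum (Aπ n P) x t + + (n ℕ.+ 1)
    ≡⟨ cong (_+ + (n ℕ.+ 1)) (mulVecᵀ-sgn-mulVec (Aπ n P) x t) ⟨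
  mulVecᵀ (Aπ n P) (map sgn (mulVec (Aπ n P) x)) t + + (n ℕ.+ 1) ∎
  where
  open ≡-Reasoning
  z : Fin (n ℕ.* n) → ℤ
  z = x ∘ (P ⟨$⟩ʳ_)
  nonzero-z : All (λ v → v ≢ + 0) (mulVec (A n) z)
  nonzero-z = subst (All (λ v → v ≢ + 0)) (mulVec-permuteColumns P (A n) x) nonzero

-- The identity holds at every coordinate of x; the clue data enter only through x (idx l) ≡ g l.
mainTheorem3 : (n : ℕ) → n ≥ 2 →
    (π : Fin 3 → Permutation′ (n ℕ.* n)) →
    (k : ℕ) → k ℕ.≤ n ℕ.* n →
    (idx : Fin k → Fin (n ℕ.* n)) → Injective _≡_ _≡_ idx →
    (g : Fin k → ℤ) → (∀ l → + 1 ℤ.≤ g l × g l ℤ.≤ + n) →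
    (x : Fin (n ℕ.* n) → ℤ) →
    (∀ i → + 1 ℤ.≤ x i × x i ℤ.≤ + n) →
    (∀ r → All (λ v → v ≢ + 0) (mulVec (Aπ n (π r)) x)) →
    (∀ l → x (idx l) ≡ g l) →
    ∀ l r → + 2 * g l ≡
      mulVecᵀ (Aπ n (π r)) (map sgn (mulVec (Aπ n (π r)) x)) (idx l) + + (n ℕ.+ 1)
mainTheorem3 n _ π k _ idx _ g _ x bounds nonzero x≡g l r =
  trans (cong (+ 2 *_) (sym (x≡g l))) (mulVecᵀ-Aπ-recovers n (π r) x bounds (nonzero r) (idx l))
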